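{- Let $G=(V,A)$ be a finite simple directed graph without loops and let $k\ge 2$ be an integer. Let $G_F=(V,A_F)$ be the spanning subgraph of $G$ whose arc set $A_F$ consists of the arcs of $G$ that belong to at least one directed cycle of $G$ of length at least 2 and at most $k$. Then $C_k(G)=S(G_F)$, where $S(G_F)$ is the strong connectivity relation of $G_F$: $u\,S\,v$ iff $v$ is reachable from $u$ and $u$ is reachable from $v$ in $G_F$ (a vertex being reachable from itself).
   Context: Reachability: $v$ is reachable from $u$ iff $u=v$ or there is a directed walk from $u$ to $v$. $u\,C_k\,v$ in $G$ iff $u=v$ or there is a sequence $(C_1,\dots,C_s)$ of directed cycles of $G$, each of length at least 2 and at most $k$, with $u\in V(C_1)$, $v\in V(C_s)$ and $V(C_{i-1})\cap V(C_i)\neq\emptyset$ for $i=2,\dots,s$. -}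

module Defs where

open import Data.Nat using (ℕ; suc; _≤_)
open import Data.Fin using (Fin; zero; suc; inject₁; fromℕ)
open import Data.Bool using (Bool; T)
open import Data.Product using (Σ; ∃; _×_; _,_)
open import Data.Sum using (_⊎_)
open import Function.Definitions using (Injective)
open import Relation.Binary.PropositionalEquality using (_≡_)
open import Relation.Binary.Construct.Closure.ReflexiveTransitive using (Star)
open import Level using (0ℓ)

-- A finite simple digraph on vertex set Fin n: an adjacency function
-- (at most one arc per ordered pair, by construction).
Digraph : ℕ → Set
Digraph n = Fin n → Fin n → Bool

Arc : ∀ {n} → Digraph n → Fin n → Fin n → Set
Arc E u v = T (E u v)

Loopless : ∀ {n} → Digraph n → Set
Loopless {n} E = (v : Fin n) → E v v ≡ Data.Bool.false
  where import Data.Bool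

record Cycle {n : ℕ} (E : Digraph n) : Set where
  field
    m     : ℕ
    vtx   : Fin (suc m) → Fin n
    inj   : Injective _≡_ _≡_ vtx
    step  : (i : Fin m) → Arc E (vtx (inject₁ i)) (vtx (suc i))
    close : Arc E (vtx (fromℕ m)) (vtx zero)

  length : ℕ
  length = suc m

open Cycle public

Short : ∀ {n} {E : Digraph n} → ℕ → Cycle E → Set
Short k C = 2 ≤ length C × length C ≤ k

_∈V_ : ∀ {n} {E : Digraph n} → Fin n → Cycle E → Set
v ∈V C = ∃ λ i → vtx C i ≡ v

ArcOf : ∀ {n} {E : Digraph n} → Cycle E → Fin n → Fin n → Set
ArcOf C u v =
  (∃ λ i → vtx C (inject₁ i) ≡ u × vtx C (suc i) ≡ v)
  ⊎ (vtx C (fromℕ (m C)) ≡ u × vtx C zero ≡ v)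

ArcF : ∀ {n} → ℕ → Digraph n → Fin n → Fin n → Set
ArcF k E u v = Arc E u v × Σ (Cycle E) λ C → Short k C × ArcOf C u v

Reachable : ∀ {n} → (Fin n → Fin n → Set) → Fin n → Fin n → Set
Reachable R = Star R

S-F : ∀ {n} → ℕ → Digraph n → Fin n → Fin n → Set
S-F k E u v = Reachable (ArcF k E) u v × Reachable (ArcF k E) v u

-- ChainTo k C v : a sequence of short cycles C = C₁, …, C_s with
-- consecutive cycles sharing a vertex and v ∈ V(C_s)
data ChainTo {n} (k : ℕ) (E : Digraph n) : Cycle E → Fin n → Set where
  here : ∀ {C v} → v ∈V C → ChainTo k E C v
  next : ∀ {C D v} → Short k D → (∃ λ w → w ∈V C × w ∈V D) →
         ChainTo k E D v → ChainTo k E C v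

Ck : ∀ {n} → ℕ → Digraph n → Fin n → Fin n → Set
Ck k E u v = u ≡ v ⊎ Σ (Cycle E) λ C → Short k C × u ∈V C × ChainTo k E C v

{-# OPTIONS --safe #-}
-- Every arc of G_F lies on a short cycle, so a G_F-walk from u to v yields a
-- chain of short cycles in which consecutive cycles share a vertex of the
-- walk. Conversely, the vertices of a short cycle are mutually reachable
-- along its arcs, all of which are arcs of G_F, and mutual reachability
-- composes along a chain of such cycles.
module Submission where

open import Defs
open import Data.Nat using (ℕ; _≤_; zero; suc)
open import Data.Fin using (Fin; zero; suc; inject₁; fromℕ)
open import Data.Product using (_×_; _,_; proj₁)
open import Data.Sum using (inj₁; inj₂)
open import Function.Base using (_∘_)
open import Function.Bundles using (_⇔_; mk⇔)
open import Relation.Binary.PropositionalEquality using (refl)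
open import Relation.Binary.Construct.Closure.ReflexiveTransitive using (Star; ε; _◅_; _◅◅_)

module _ {A : Set} (R : A → A → Set) where

  Steps : ∀ m → (Fin (suc m) → A) → Set
  Steps m f = (i : Fin m) → R (f (inject₁ i)) (f (suc i))

  star-from-zero : ∀ m (f : Fin (suc m) → A) → Steps m f →
                   ∀ j → Star R (f zero) (f j)
  star-from-zero m       f st zero    = ε
  star-from-zero (suc m) f st (suc j) =
    star-from-zero m (λ i → f (inject₁ i)) (λ i → st (inject₁ i)) j ◅◅ (st j ◅ ε)

  star-to-last : ∀ m (f : Fin (suc m) → A) → Steps m f →
                 ∀ j → Star R (f j) (f (fromℕ m))
  star-to-last zero    f st zero    = ε
  star-to-last (suc m) f st zero    =
    st zero ◅ star-to-last m (λ i → f (suc i)) (λ i → st (suc i)) zero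
  star-to-last (suc m) f st (suc j) =
    star-to-last m (λ i → f (suc i)) (λ i → st (suc i)) j

module _ {n : ℕ} (k : ℕ) (E : Digraph n) where

  short-cycle-reachable : (C : Cycle E) → Short k C →
                          ∀ {a b} → a ∈V C → b ∈V C → Reachable (ArcF k E) a b
  short-cycle-reachable C short (i , refl) (j , refl) =
    star-to-last (ArcF k E) (m C) (vtx C) steps i
      ◅◅ closing ◅ star-from-zero (ArcF k E) (m C) (vtx C) steps j
    where
    steps : Steps (ArcF k E) (m C) (vtx C)
    steps i = step C i , C , short , inj₁ (i , refl , refl)

    closing : ArcF k E (vtx C (fromℕ (m C))) (vtx C zero)
    closing = close C , C , short , inj₂ (refl , refl)

  chain⇒S-F : ∀ {u v} (C : Cycle E) → Short k C → u ∈V C →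
              ChainTo k E C v → S-F k E u v
  chain⇒S-F C short u∈C (here v∈C) =
    short-cycle-reachable C short u∈C v∈C , short-cycle-reachable C short v∈C u∈C
  chain⇒S-F C short u∈C (next {D = D} shortD (w , w∈C , w∈D) rest)
    with chain⇒S-F D shortD w∈D rest
  ... | w⇝v , v⇝w =
    short-cycle-reachable C short u∈C w∈C ◅◅ w⇝v ,
    v⇝w ◅◅ short-cycle-reachable C short w∈C u∈C

  Ck⇒S-F : ∀ {u v} → Ck k E u v → S-F k E u v
  Ck⇒S-F (inj₁ refl)                 = ε , ε
  Ck⇒S-F (inj₂ (C , short , u∈C , ch)) = chain⇒S-F C short u∈C ch

  arcOf-endpoints : ∀ {u w} (C : Cycle E) → ArcOf C u w → u ∈V C × w ∈V C
  arcOf-endpoints C (inj₁ (i , p , q)) = (inject₁ i , p) , (suc i , q)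
  arcOf-endpoints C (inj₂ (p , q))     = (fromℕ (m C) , p) , (zero , q)

  reachable⇒Ck : ∀ {u v} → Reachable (ArcF k E) u v → Ck k E u v
  reachable⇒Ck ε = inj₁ refl
  reachable⇒Ck (_◅_ {j = w} (_ , C , short , arc) rest)
    with arcOf-endpoints C arc | reachable⇒Ck rest
  ... | u∈C , w∈C | inj₁ refl =
    inj₂ (C , short , u∈C , here w∈C)
  ... | u∈C , w∈C | inj₂ (D , shortD , w∈D , ch) =
    inj₂ (C , short , u∈C , next shortD (w , w∈C , w∈D) ch)

theorem18 : (n : ℕ) (E : Digraph n) → Loopless E → (k : ℕ) → 2 ≤ k →
            (u v : Fin n) → Ck k E u v ⇔ S-F k E u v
theorem18 n E _ k _ u v = mk⇔ (Ck⇒S-F k E) (reachable⇒Ck k E ∘ proj₁)
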